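{- Let $k\ge 1$ be an integer. Let $G_L$ be an $\ell$-$LP_1$-snark with $\sigma\ge 1$ link-vertices, where $\ell\ge 3$ is odd. Then $i_{[kR]}(G_L)\le 2(k+1)\ell+k\sigma$.
   Context: A basic block $B_i$ has vertices $p_i,q_i,r_i,s_i,t_i,u_i,v_i$ and edges $p_it_i,t_iq_i,q_ir_i,r_is_i,s_ip_i,u_iv_i,u_ip_i,v_iq_i$. For odd $\ell\ge3$, an $\ell$-$LP_1$-snark is built from disjoint blocks $B_0,\ldots,B_{\ell-1}$ as follows: for each $i\in\{0,\ldots,\ell-1\}$ (indices modulo $\ell$) add either the pair of edges $\{s_ir_{i+1},v_iu_{i+1}\}$ or the pair $\{s_iu_{i+1},v_ir_{i+1}\}$ (plug-edges); then choose an odd number $\sigma$ with $1\le\sigma\le\lfloor\ell/3\rfloor$ of pairwise disjoint triples $\{t_i,t_j,t_s\}$ and for each such triple add a new vertex (link-vertex) adjacent to $t_i,t_j,t_s$; finally, the remaining $\ell-3\sigma$ vertices $t_i$ are paired up and each pair $t_i,t_j$ is joined by an edge (repairing edge). For $f\colon V(G)\to\mathbb{Z}_{\ge 0}$ and $S\subseteq V(G)$, $f(S)=\sum_{v\in S}f(v)$, and $AN(v)=\{w\in N(v): f(w)\ge 1\}$. A $[k]$-Roman dominating function of $G$ is a function $f\colon V(G)\to\{0,1,\ldots,k+1\}$ such that $f(N[v])\ge k+|AN(v)|$ for every vertex $v$ with $f(v)<k$; its weight is $f(V(G))$. $i_{[kR]}(G)$ is the minimum weight of such a function whose set of vertices with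 positive label is independent. -}

module Defs where

open import Data.Nat using (ℕ; zero; suc; _+_; _*_; _≤_; _<_; _/_)
open import Data.Nat.DivMod using (_mod_)
open import Data.Fin using (Fin; toℕ)
open import Data.Fin.Properties using () renaming (_≟_ to _≟ᶠ_)
open import Data.Bool using (Bool; true; false; _∧_; _∨_; if_then_else_)
open import Data.List using (List; []; _∷_; _++_; map; concatMap; allFin; cartesianProduct)
open import Data.Nat.ListAction using (sum)
open import Data.Bool.ListAction using (any)
open import Data.Product using (_×_; _,_; proj₁; proj₂; Σ; ∃)
open import Data.Sum using (_⊎_; inj₁; inj₂)
open import Relation.Nullary.Decidable using (⌊_⌋)
open import Relation.Binary.PropositionalEquality using (_≡_; _≢_)

record FinGraph : Set₁ where
  field
    V     : Set
    verts : List V              -- each vertex listed exactly once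
    adj   : V → V → Bool

open FinGraph public

module _ (G : FinGraph) (f : V G → ℕ) where

  weight : ℕ
  weight = sum (map f (verts G))

  fClosedNbhd : V G → ℕ
  fClosedNbhd v = f v + sum (map (λ w → if adj G v w then f w else 0) (verts G))

  numActiveNbrs : V G → ℕ
  numActiveNbrs v =
    sum (map (λ w → if adj G v w then (pos (f w)) else 0) (verts G))
    where
    pos : ℕ → ℕ
    pos zero    = 0
    pos (suc _) = 1

record IsKRDF (k : ℕ) (G : FinGraph) (f : V G → ℕ) : Set where
  field
    range    : ∀ v → f v ≤ suc k
    dominate : ∀ v → f v < k → k + numActiveNbrs G f v ≤ fClosedNbhd G f v

IsIndepLabel : (G : FinGraph) → (V G → ℕ) → Set
IsIndepLabel G f = ∀ u w → adj G u w ≡ true → 1 ≤ f u → 1 ≤ f w → Data.Empty.⊥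
  where import Data.Empty

IKRAtMost : ℕ → FinGraph → ℕ → Set
IKRAtMost k G b = Σ (V G → ℕ) λ f → IsKRDF k G f × IsIndepLabel G f × weight G f ≤ b

Odd : ℕ → Set
Odd n = ∃ λ m → n ≡ suc (2 * m)

-- the seven vertices of a basic block
data Lbl : Set where
  p q r s t u v : Lbl

allLbl : List Lbl
allLbl = p ∷ q ∷ r ∷ s ∷ t ∷ u ∷ v ∷ []

eqLbl : Lbl → Lbl → Bool
eqLbl p p = true
eqLbl q q = true
eqLbl r r = true
eqLbl s s = true
eqLbl t t = true
eqLbl u u = true
eqLbl v v = true
eqLbl _ _ = false

_==ᶠ_ : ∀ {n} → Fin n → Fin n → Bool
i ==ᶠ j = ⌊ i ≟ᶠ j ⌋

next : ∀ {ℓ} → Fin ℓ → Fin ℓ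
next {suc m} i = suc (toℕ i) mod (suc m)

-- vertices: block vertices (i , x) = x_i, and link-vertices
SV : ℕ → ℕ → Set
SV ℓ σ = (Fin ℓ × Lbl) ⊎ Fin σ

eqSV : ∀ {ℓ σ} → SV ℓ σ → SV ℓ σ → Bool
eqSV (inj₁ (i , x)) (inj₁ (j , y)) = (i ==ᶠ j) ∧ eqLbl x y
eqSV (inj₂ a)       (inj₂ b)       = a ==ᶠ b
eqSV _              _              = false

allSV : ∀ ℓ σ → List (SV ℓ σ)
allSV ℓ σ = map inj₁ (cartesianProduct (allFin ℓ) allLbl) ++ map inj₂ (allFin σ)

-- The data of the construction.
--  * plug i = true  : plug-edges s_i r_{i+1}, v_i u_{i+1}
--    plug i = false : plug-edges s_i u_{i+1}, v_i r_{i+1}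
--  * triple j = the triple {t_i,t_j,t_s} of the j-th link-vertex
--  * partner : the pairing of the remaining t-vertices by repairing edges
record LP1Data (ℓ σ : ℕ) : Set where
  field
    plug    : Fin ℓ → Bool
    triple  : Fin σ → Fin 3 → Fin ℓ
    partner : Fin ℓ → Fin ℓ

  inTriple : Fin ℓ → Bool
  inTriple i = any (λ ja → triple (proj₁ ja) (proj₂ ja) ==ᶠ i)
                   (cartesianProduct (allFin σ) (allFin 3))

open LP1Data public

record ValidLP1 (ℓ σ : ℕ) (D : LP1Data ℓ σ) : Set where
  field
    ℓ-odd   : Odd ℓ
    ℓ≥3     : 3 ≤ ℓ
    σ-odd   : Odd σ
    σ≥1     : 1 ≤ σ
    σ≤ℓ/3   : σ ≤ ℓ / 3
    -- the triples are 3-element sets and pairwise disjoint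
    triple-inj : ∀ j a j′ a′ → triple D j a ≡ triple D j′ a′ → (j ≡ j′ × a ≡ a′)
    -- the remaining t_i are paired up (fixed-point-free involution on them)
    partner-ne  : ∀ i → inTriple D i ≡ false → partner D i ≢ i
    partner-out : ∀ i → inTriple D i ≡ false → inTriple D (partner D i) ≡ false
    partner-inv : ∀ i → inTriple D i ≡ false → partner D (partner D i) ≡ i

module _ {ℓ σ : ℕ} (D : LP1Data ℓ σ) where

  private
    B : Fin ℓ → Lbl → SV ℓ σ
    B i x = inj₁ (i , x)

  blockEdges : Fin ℓ → List (SV ℓ σ × SV ℓ σ)
  blockEdges i =
    (B i p , B i t) ∷ (B i t , B i q) ∷ (B i q , B i r) ∷ (B i r , B i s) ∷
    (B i s , B i p) ∷ (B i u , B i v) ∷ (B i u , B i p) ∷ (B i v , B i q) ∷ []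

  plugEdges : Fin ℓ → List (SV ℓ σ × SV ℓ σ)
  plugEdges i with plug D i
  ... | true  = (B i s , B (next i) r) ∷ (B i v , B (next i) u) ∷ []
  ... | false = (B i s , B (next i) u) ∷ (B i v , B (next i) r) ∷ []

  linkEdges : Fin σ → List (SV ℓ σ × SV ℓ σ)
  linkEdges j = map (λ a → (inj₂ j , B (triple D j a) t)) (allFin 3)

  repairEdges : Fin ℓ → List (SV ℓ σ × SV ℓ σ)
  repairEdges i with inTriple D i
  ... | true  = []
  ... | false = (B i t , B (partner D i) t) ∷ []

  snarkEdges : List (SV ℓ σ × SV ℓ σ)
  snarkEdges = concatMap blockEdges (allFin ℓ) ++ concatMap plugEdges (allFin ℓ)
            ++ concatMap linkEdges (allFin σ) ++ concatMap repairEdges (allFin ℓ)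

  snarkAdj : SV ℓ σ → SV ℓ σ → Bool
  snarkAdj x y = any (λ e → (eqSV (proj₁ e) x ∧ eqSV (proj₂ e) y)
                          ∨ (eqSV (proj₁ e) y ∧ eqSV (proj₂ e) x)) snarkEdges

  LP1Snark : FinGraph
  LP1Snark = record { V = SV ℓ σ ; verts = allSV ℓ σ ; adj = snarkAdj }

{-# OPTIONS --safe #-}
module Submission where

-- Label p_i and q_i by k + 1, every link-vertex by k and all other vertices by 0.
-- Every edge of the snark has an endpoint among r_i, s_i, t_i, u_i, v_i, so the
-- positive labels form an independent set.  A vertex labelled below k is one of
-- these five and has p_i or q_i as a neighbour in its own block: that neighbour
-- alone pays k + 1 towards f(N[v]), while every other active neighbour pays at
-- least the 1 it adds to |AN(v)|.

open import Defs
open import Algebra.Properties.CommutativeSemigroup using (x∙yz≈y∙xz)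
open import Data.Bool using (Bool; true; false; T; _∧_; _∨_; if_then_else_)
open import Data.Bool.Properties using (T-≡; T-∧; T-∨)
open import Data.Empty using (⊥-elim)
open import Data.Fin using (Fin)
open import Data.List using (List; []; _∷_; _++_; map; concatMap; allFin; cartesianProduct; length)
open import Data.List.Membership.Propositional using (_∈_; lose)
open import Data.List.Membership.Propositional.Properties
  using (∈-allFin; ∈-cartesianProduct⁺)
open import Data.List.Properties using (map-++; map-∘; length-tabulate)
open import Data.List.Relation.Unary.All using (All; []; _∷_; universal; lookupWith)
import Data.List.Relation.Unary.All.Properties as All
open import Data.List.Relation.Unary.Any as Any using (Any; here; there)
import Data.List.Relation.Unary.Any.Properties as Any
open import Data.Nat using (ℕ; suc; _+_; _*_; _⊓_; _≤_; _<_; z≤n)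
open import Data.Nat.ListAction using (sum)
open import Data.Nat.ListAction.Properties using (sum-++)
open import Data.Nat.Properties
  using ( +-assoc; +-comm; +-commutativeSemigroup; +-mono-≤; +-monoʳ-≤; m≤n+m; n≤1+n
        ; m≤n⊓o⇒m≤n; m≤n⊓o⇒m≤o; ≤-refl; ≤-reflexive; <-irrefl; <⇒≱; m<n⇒n≢0; module ≤-Reasoning)
open import Data.Nat.Tactic.RingSolver using (solve-∀)
open import Data.Product using (Σ; _×_; _,_; proj₂)
open import Data.Sum using (_⊎_; inj₁; inj₂; [_,_]; [_,_]′; swap)
open import Function using (_∘_; id; const; _⇔_; mk⇔; Equivalence)
open import Relation.Nullary.Decidable using (toWitness; fromWitness)
open import Relation.Binary.PropositionalEquality
  using (_≡_; refl; sym; trans; cong; cong₂; module ≡-Reasoning)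

sum-map-mono : ∀ {A : Set} {g h : A → ℕ} → (∀ x → g x ≤ h x) →
               ∀ xs → sum (map g xs) ≤ sum (map h xs)
sum-map-mono g≤h []       = z≤n
sum-map-mono g≤h (x ∷ xs) = +-mono-≤ (g≤h x) (sum-map-mono g≤h xs)

sum-map-mono-with-gap : ∀ {A : Set} {g h : A → ℕ} {k w xs} → (∀ x → g x ≤ h x) →
                        w ∈ xs → k + g w ≤ h w → k + sum (map g xs) ≤ sum (map h xs)
sum-map-mono-with-gap {g = g} {h} {k} {xs = x ∷ xs} g≤h (here refl) gap = begin
  k + (g x + sum (map g xs)) ≡⟨ +-assoc k (g x) _ ⟨
  k + g x + sum (map g xs)   ≤⟨ +-mono-≤ gap (sum-map-mono g≤h xs) ⟩
  h x + sum (map h xs)       ∎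
  where open ≤-Reasoning
sum-map-mono-with-gap {g = g} {h} {k} {xs = x ∷ xs} g≤h (there w∈xs) gap = begin
  k + (g x + sum (map g xs)) ≡⟨ x∙yz≈y∙xz +-commutativeSemigroup k (g x) _ ⟩
  g x + (k + sum (map g xs)) ≤⟨ +-mono-≤ (g≤h x) (sum-map-mono-with-gap g≤h w∈xs gap) ⟩
  h x + sum (map h xs)       ∎
  where open ≤-Reasoning

sum-map-const : ∀ {A : Set} (c : ℕ) (xs : List A) → sum (map (const c) xs) ≡ length xs * c
sum-map-const c []       = refl
sum-map-const c (x ∷ xs) = cong (c +_) (sum-map-const c xs)

sum-map-proj₂-cartesianProduct : ∀ {A B : Set} (g : B → ℕ) (xs : List A) (ys : List B) →
  sum (map (g ∘ proj₂) (cartesianProduct xs ys)) ≡ length xs * sum (map g ys)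
sum-map-proj₂-cartesianProduct g []       ys = refl
sum-map-proj₂-cartesianProduct g (x ∷ xs) ys = begin
  sum (map (g ∘ proj₂) (map (x ,_) ys ++ cartesianProduct xs ys))
    ≡⟨ cong sum (map-++ (g ∘ proj₂) (map (x ,_) ys) _) ⟩
  sum (map (g ∘ proj₂) (map (x ,_) ys) ++ map (g ∘ proj₂) (cartesianProduct xs ys))
    ≡⟨ sum-++ (map (g ∘ proj₂) (map (x ,_) ys)) _ ⟩
  sum (map (g ∘ proj₂) (map (x ,_) ys)) + sum (map (g ∘ proj₂) (cartesianProduct xs ys))
    ≡⟨ cong₂ _+_ (cong sum (sym (map-∘ ys))) (sum-map-proj₂-cartesianProduct g xs ys) ⟩
  sum (map g ys) + length xs * sum (map g ys) ∎
  where open ≡-Reasoning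

All-concatMap : ∀ {A B : Set} {P : B → Set} {g : A → List B} →
                (∀ a → All P (g a)) → ∀ as → All P (concatMap g as)
All-concatMap Pg as = All.concat⁺ (All.map⁺ (universal Pg as))

if-then-0-mono : ∀ b {m n} → m ≤ n → (if b then m else 0) ≤ (if b then n else 0)
if-then-0-mono true  m≤n = m≤n
if-then-0-mono false _   = z≤n

module _ (G : FinGraph) where

  neighbourSum : (V G → ℕ) → V G → ℕ
  neighbourSum c x = sum (map (λ y → if adj G x y then c y else 0) (verts G))

  -- numActiveNbrs counts the indicator 1 ⊓ f y through a function local to Defs,
  -- which cannot be named here; c is unified with it at the use site.
  dominated-by-heavy-neighbour : ∀ {k x w} {c d : V G → ℕ} → (∀ y → c y ≤ 1 ⊓ d y) →
    w ∈ verts G → adj G x w ≡ true → k < d w → k + neighbourSum c x ≤ d x + neighbourSum d x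
  dominated-by-heavy-neighbour {k} {x} {w} {c} {d} c≤ w∈ xw k<dw = begin
    k + neighbourSum c x ≤⟨ sum-map-mono-with-gap c≤d w∈ gap ⟩
    neighbourSum d x     ≤⟨ m≤n+m _ (d x) ⟩
    d x + neighbourSum d x ∎
    where
    open ≤-Reasoning
    c≤d : ∀ y → (if adj G x y then c y else 0) ≤ (if adj G x y then d y else 0)
    c≤d y = if-then-0-mono (adj G x y) (m≤n⊓o⇒m≤o 1 (d y) (c≤ y))
    gap : k + (if adj G x w then c w else 0) ≤ (if adj G x w then d w else 0)
    gap rewrite xw = begin
      k + c w ≤⟨ +-monoʳ-≤ k (m≤n⊓o⇒m≤n 1 (d w) (c≤ w)) ⟩
      k + 1   ≡⟨ +-comm k 1 ⟩
      suc k   ≤⟨ k<dw ⟩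
      d w     ∎

eqLbl-sound : ∀ x y → T (eqLbl x y) → x ≡ y
eqLbl-sound p p _ = refl
eqLbl-sound q q _ = refl
eqLbl-sound r r _ = refl
eqLbl-sound s s _ = refl
eqLbl-sound t t _ = refl
eqLbl-sound u u _ = refl
eqLbl-sound v v _ = refl

eqLbl-refl : ∀ x → T (eqLbl x x)
eqLbl-refl p = _
eqLbl-refl q = _
eqLbl-refl r = _
eqLbl-refl s = _
eqLbl-refl t = _
eqLbl-refl u = _
eqLbl-refl v = _

∈-allLbl : ∀ x → x ∈ allLbl
∈-allLbl p = here refl
∈-allLbl q = there (here refl)
∈-allLbl r = there (there (here refl))
∈-allLbl s = there (there (there (here refl)))
∈-allLbl t = there (there (there (there (here refl))))
∈-allLbl u = there (there (there (there (there (here refl)))))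
∈-allLbl v = there (there (there (there (there (there (here refl))))))

module _ {ℓ σ : ℕ} where

  eqSV-sound : ∀ (a b : SV ℓ σ) → T (eqSV a b) → a ≡ b
  eqSV-sound (inj₁ (i , x)) (inj₁ (j , y)) a≡b
    with i≡j , x≡y ← Equivalence.to T-∧ a≡b =
    cong₂ (λ i x → inj₁ (i , x)) (toWitness i≡j) (eqLbl-sound x y x≡y)
  eqSV-sound (inj₂ a) (inj₂ b) a≡b = cong inj₂ (toWitness a≡b)

  eqSV-refl : ∀ (a : SV ℓ σ) → T (eqSV a a)
  eqSV-refl (inj₁ (i , x)) = Equivalence.from T-∧ (fromWitness refl , eqLbl-refl x)
  eqSV-refl (inj₂ a)       = fromWitness refl

  ∈-allSV : ∀ (x : SV ℓ σ) → x ∈ allSV ℓ σ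
  ∈-allSV (inj₁ (i , x)) =
    Any.++⁺ˡ (Any.map⁺ (Any.map (cong inj₁) (∈-cartesianProduct⁺ (∈-allFin i) (∈-allLbl x))))
  ∈-allSV (inj₂ j) = Any.++⁺ʳ _ (Any.map⁺ (Any.map (cong inj₂) (∈-allFin j)))

  Joins : SV ℓ σ → SV ℓ σ → SV ℓ σ × SV ℓ σ → Set
  Joins x y e = (x , y) ≡ e ⊎ (y , x) ≡ e

  joins? : SV ℓ σ → SV ℓ σ → SV ℓ σ × SV ℓ σ → Bool
  joins? x y (a , b) = (eqSV a x ∧ eqSV b y) ∨ (eqSV a y ∧ eqSV b x)

  joins?-sound : ∀ {x y} e → T (joins? x y e) → Joins x y e
  joins?-sound {x} {y} (a , b) h with Equivalence.to T-∨ h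
  ... | inj₁ ax∧by = let ax , by = Equivalence.to T-∧ ax∧by in
    inj₁ (sym (cong₂ _,_ (eqSV-sound a x ax) (eqSV-sound b y by)))
  ... | inj₂ ay∧bx = let ay , bx = Equivalence.to T-∧ ay∧bx in
    inj₂ (sym (cong₂ _,_ (eqSV-sound a y ay) (eqSV-sound b x bx)))

  joins?-complete : ∀ {x y} e → Joins x y e → T (joins? x y e)
  joins?-complete {x} {y} _ (inj₁ refl) =
    Equivalence.from T-∨ (inj₁ (Equivalence.from T-∧ (eqSV-refl x , eqSV-refl y)))
  joins?-complete {x} {y} _ (inj₂ refl) =
    Equivalence.from T-∨ (inj₂ (Equivalence.from T-∧ (eqSV-refl y , eqSV-refl x)))

blockLabel : ℕ → Lbl → ℕ
blockLabel k p = suc k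
blockLabel k q = suc k
blockLabel k _ = 0

snarkLabel : ∀ {ℓ σ} → ℕ → SV ℓ σ → ℕ
snarkLabel k = [ blockLabel k ∘ proj₂ , const k ]

snarkLabel-range : ∀ {ℓ σ} k (x : SV ℓ σ) → snarkLabel k x ≤ suc k
snarkLabel-range k (inj₁ (_ , p)) = ≤-refl
snarkLabel-range k (inj₁ (_ , q)) = ≤-refl
snarkLabel-range k (inj₁ (_ , r)) = z≤n
snarkLabel-range k (inj₁ (_ , s)) = z≤n
snarkLabel-range k (inj₁ (_ , t)) = z≤n
snarkLabel-range k (inj₁ (_ , u)) = z≤n
snarkLabel-range k (inj₁ (_ , v)) = z≤n
snarkLabel-range k (inj₂ _)       = n≤1+n k

module _ {ℓ σ : ℕ} (D : LP1Data ℓ σ) where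

  snarkAdj⇔joins : ∀ {x y} → snarkAdj D x y ≡ true ⇔ Any (Joins x y) (snarkEdges D)
  snarkAdj⇔joins {x} {y} = mk⇔
    (λ xy → Any.map (joins?-sound _) (Any.any⁻ (joins? x y) _ (Equivalence.from T-≡ xy)))
    (λ j → Equivalence.to T-≡ (Any.any⁺ (joins? x y) (Any.map (joins?-complete _) j)))

  blockEdge⇒snarkAdj : ∀ {x y} i → Any (Joins x y) (blockEdges D i) → snarkAdj D x y ≡ true
  blockEdge⇒snarkAdj i j = Equivalence.from snarkAdj⇔joins
    (Any.++⁺ˡ (Any.concat⁺ (Any.map⁺ (lose (∈-allFin i) j))))

  All-snarkEdges : ∀ {P : SV ℓ σ × SV ℓ σ → Set} →
    (∀ i → All P (blockEdges D i)) → (∀ i → All P (plugEdges D i)) →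
    (∀ j → All P (linkEdges D j)) → (∀ i → All P (repairEdges D i)) → All P (snarkEdges D)
  All-snarkEdges block plug link repair =
    All.++⁺ (All-concatMap block (allFin ℓ)) (All.++⁺ (All-concatMap plug (allFin ℓ))
      (All.++⁺ (All-concatMap link (allFin σ)) (All-concatMap repair (allFin ℓ))))

  ZeroEnd : (SV ℓ σ → ℕ) → SV ℓ σ × SV ℓ σ → Set
  ZeroEnd f (a , b) = f a ≡ 0 ⊎ f b ≡ 0

  zeroEnds⇒indep : ∀ {f} → All (ZeroEnd f) (snarkEdges D) → IsIndepLabel (LP1Snark D) f
  zeroEnds⇒indep {f} zeroEnds x y xy 0<fx 0<fy =
    [ m<n⇒n≢0 0<fx , m<n⇒n≢0 0<fy ]′
      (lookupWith joinedZeroEnd zeroEnds (Equivalence.to snarkAdj⇔joins xy))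
    where
    joinedZeroEnd : ∀ {e} → ZeroEnd f e → Joins x y e → f x ≡ 0 ⊎ f y ≡ 0
    joinedZeroEnd z (inj₁ refl) = z
    joinedZeroEnd z (inj₂ refl) = swap z

  heavy-neighbour : ∀ {k} (x : SV ℓ σ) → snarkLabel k x < k →
                    Σ (SV ℓ σ) λ w → snarkAdj D x w ≡ true × k < snarkLabel k w
  heavy-neighbour (inj₁ (i , p)) p<k = ⊥-elim (<⇒≱ p<k (n≤1+n _))
  heavy-neighbour (inj₁ (i , q)) q<k = ⊥-elim (<⇒≱ q<k (n≤1+n _))
  heavy-neighbour (inj₁ (i , r)) _ =
    inj₁ (i , q) , blockEdge⇒snarkAdj i (there (there (here (inj₂ refl)))) , ≤-refl
  heavy-neighbour (inj₁ (i , s)) _ =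
    inj₁ (i , p) ,
    blockEdge⇒snarkAdj i (there (there (there (there (here (inj₁ refl)))))) , ≤-refl
  heavy-neighbour (inj₁ (i , t)) _ =
    inj₁ (i , p) , blockEdge⇒snarkAdj i (here (inj₂ refl)) , ≤-refl
  heavy-neighbour (inj₁ (i , u)) _ =
    inj₁ (i , p) ,
    blockEdge⇒snarkAdj i (there (there (there (there (there (there (here (inj₁ refl)))))))) ,
    ≤-refl
  heavy-neighbour (inj₁ (i , v)) _ =
    inj₁ (i , q) ,
    blockEdge⇒snarkAdj i (there (there (there (there (there (there (there (here (inj₁ refl))))))))) ,
    ≤-refl
  heavy-neighbour (inj₂ _) k<k = ⊥-elim (<-irrefl refl k<k)

  -- Stated for k = suc n so that the indicator of the link label k computes.
  snarkLabel-dominating : ∀ n (x : SV ℓ σ) → snarkLabel (suc n) x < suc n →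
    suc n + numActiveNbrs (LP1Snark D) (snarkLabel (suc n)) x
      ≤ fClosedNbhd (LP1Snark D) (snarkLabel (suc n)) x
  snarkLabel-dominating n x x<k with w , xw , k<w ← heavy-neighbour x x<k =
    dominated-by-heavy-neighbour (LP1Snark D)
      (λ { (inj₁ (_ , p)) → ≤-refl ; (inj₁ (_ , q)) → ≤-refl ; (inj₁ (_ , r)) → ≤-refl
         ; (inj₁ (_ , s)) → ≤-refl ; (inj₁ (_ , t)) → ≤-refl ; (inj₁ (_ , u)) → ≤-refl
         ; (inj₁ (_ , v)) → ≤-refl ; (inj₂ _) → ≤-refl })
      (∈-allSV w) xw k<w

  snarkLabel-zeroEnds : ∀ k → All (ZeroEnd (snarkLabel k)) (snarkEdges D)
  snarkLabel-zeroEnds k = All-snarkEdges onBlock onPlug onLink onRepair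
    where
    onBlock : ∀ i → All (ZeroEnd (snarkLabel k)) (blockEdges D i)
    onBlock i = inj₂ refl ∷ inj₁ refl ∷ inj₂ refl ∷ inj₁ refl
              ∷ inj₁ refl ∷ inj₁ refl ∷ inj₁ refl ∷ inj₁ refl ∷ []
    onPlug : ∀ i → All (ZeroEnd (snarkLabel k)) (plugEdges D i)
    onPlug i with plug D i
    ... | true  = inj₁ refl ∷ inj₁ refl ∷ []
    ... | false = inj₁ refl ∷ inj₁ refl ∷ []
    onLink : ∀ j → All (ZeroEnd (snarkLabel k)) (linkEdges D j)
    onLink j = inj₂ refl ∷ inj₂ refl ∷ inj₂ refl ∷ []
    onRepair : ∀ i → All (ZeroEnd (snarkLabel k)) (repairEdges D i)
    onRepair i with inTriple D i
    ... | true  = []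
    ... | false = inj₁ refl ∷ []

  weight-blockwise : ∀ (g : Lbl → ℕ) c →
    weight (LP1Snark D) [ g ∘ proj₂ , const c ] ≡ ℓ * sum (map g allLbl) + σ * c
  weight-blockwise g c = begin
    sum (map f (map inj₁ blockVerts ++ map inj₂ (allFin σ)))
      ≡⟨ cong sum (map-++ f (map inj₁ blockVerts) _) ⟩
    sum (map f (map inj₁ blockVerts) ++ map f (map inj₂ (allFin σ)))
      ≡⟨ sum-++ (map f (map inj₁ blockVerts)) _ ⟩
    sum (map f (map inj₁ blockVerts)) + sum (map f (map inj₂ (allFin σ)))
      ≡⟨ cong₂ _+_ (cong sum (sym (map-∘ blockVerts))) (cong sum (sym (map-∘ (allFin σ)))) ⟩
    sum (map (g ∘ proj₂) blockVerts) + sum (map (const c) (allFin σ))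
      ≡⟨ cong₂ _+_ (sum-map-proj₂-cartesianProduct g (allFin ℓ) allLbl)
                   (sum-map-const c (allFin σ)) ⟩
    length (allFin ℓ) * sum (map g allLbl) + length (allFin σ) * c
      ≡⟨ cong₂ (λ m n → m * sum (map g allLbl) + n * c)
               (length-tabulate {n = ℓ} id) (length-tabulate {n = σ} id) ⟩
    ℓ * sum (map g allLbl) + σ * c ∎
    where
    open ≡-Reasoning
    f : SV ℓ σ → ℕ
    f = [ g ∘ proj₂ , const c ]
    blockVerts : List (Fin ℓ × Lbl)
    blockVerts = cartesianProduct (allFin ℓ) allLbl

  snarkLabel-weight : ∀ k → weight (LP1Snark D) (snarkLabel k) ≡ 2 * (k + 1) * ℓ + k * σ
  snarkLabel-weight k = trans (weight-blockwise (blockLabel k) k) (total k ℓ σ)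
    where
    total : ∀ k ℓ σ → ℓ * (suc k + (suc k + 0)) + σ * k ≡ 2 * (k + 1) * ℓ + k * σ
    total = solve-∀

-- The labelling never looks at how the blocks are plugged, linked or repaired.
theorem5p1 : (k ℓ σ : ℕ) → 1 ≤ k → (D : LP1Data ℓ σ) → ValidLP1 ℓ σ D →
    IKRAtMost k (LP1Snark D) (2 * (k + 1) * ℓ + k * σ)
theorem5p1 (suc n) ℓ σ _ D _ =
  snarkLabel (suc n) ,
  record { range = snarkLabel-range (suc n) ; dominate = snarkLabel-dominating D n } ,
  zeroEnds⇒indep D (snarkLabel-zeroEnds D (suc n)) ,
  ≤-reflexive (snarkLabel-weight D (suc n))
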